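{- Let $k\ge 2$ and $\alpha\ge 1$ be integers, let $A$ be the $k^{\alpha}\times\alpha k$ benchmark matrix, and fix $a\in\{0,\dots,\alpha-1\}$ with clustering $\mathcal{C}^a=\{C_1^a,\dots,C_k^a\}$ as defined in the context. Let $\mu(C_j^a)=\frac{1}{|C_j^a|}\sum_{p\in C_j^a}p$ be the mean of $C_j^a$. Then every point $A_i$ is assigned to its closest center: if $A_i\in C_j^a$, then $\|A_i-\mu(C_j^a)\|_2\le\|A_i-\mu(C_h^a)\|_2$ for all $h$. Moreover, every point $A_i\in C_j^a$ has the same distance to every center $\mu(C_h^a)$ with $h\ne j$.
   Context: Benchmark construction. Fix integers $k\ge 2$, $\alpha\ge 1$, and put $n=k^{\alpha}$, $d=\alpha k$. Let $\mathbb{1}_m$ be the all-ones vector of length $m$, and let $\otimes$ be the Kronecker product, so that for a vector $v$ of length $m$, $v\otimes \mathbb{1}_k$ is the vector of length $mk$ obtained by replacing each entry $v_j$ by the block $v_j\mathbb{1}_k$, and $\mathbb{1}_r\otimes v$ is $v$ repeated $r$ times. For $i\in\{1,\dots,k\}$ let $v_i^1\in\mathbb{R}^k$ have entries $(v_i^1)_j=-\frac1k$ for $j\ne i$ and $(v_i^1)_i=\frac{k-1}{k}$; for $\ell\ge 2$ let $v_i^{\ell}=v_i^{\ell-1}\otimes\mathbb{1}_k\in\mathbb{R}^{k^{\ell}}$. The benchmark is the $n\times d$ matrix $A$ whose column $t=a k+b$, for $a\in\{0,\dots,\alpha-1\}$ and $b\in\{1,\dots,k\}$, equals $\mathbb{1}_{k^{\alpha-a-1}}\otimes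 v_b^{a+1}$. The rows $A_1,\dots,A_n$ are the input points in $\mathbb{R}^d$. For each $a$ define the clustering $\mathcal{C}^a=\{C_1^a,\dots,C_k^a\}$ of the rows by: $A_i\in C_j^a$ iff $A_{i,ak+j}>0$. -}

module Defs where

open import Data.Nat as ℕ using (ℕ; zero; suc; _∸_; _^_; _≡ᵇ_)
open import Data.Nat.DivMod using (_/_; _%_)
open import Data.Nat.Properties using (m^n≢0)
open import Data.Integer using (+_)
open import Data.Bool using (if_then_else_)
open import Data.Fin using (Fin; toℕ)
open import Data.Rational as ℚ using (ℚ; 0ℚ; _+_; _*_; _-_; -_; _<_; _≤_; _<?_)
open import Relation.Nullary.Decidable using (⌊_⌋)

ℕtoℚ : ℕ → ℚ
ℕtoℚ n = (+ n) ℚ./ 1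

-- 1/m as a rational (convention 1/0 := 0; only used with m ≥ 1)
recip : ℕ → ℚ
recip zero = 0ℚ
recip (suc m) = (+ 1) ℚ./ (suc m)

sumFin : (n : ℕ) → (Fin n → ℚ) → ℚ
sumFin zero f = 0ℚ
sumFin (suc n) f = f Fin.zero + sumFin n (λ i → f (Fin.suc i))

-- Vectors of length m are represented as functions ℕ → ℚ (only
-- indices 0..m-1 are meaningful). All indices are 0-based.
-- v^1_i (0-based i):  (v^1_i)_j = (k-1)/k if j = i, else -1/k
-- v^(ℓ+1)_i = v^ℓ_i ⊗ 1_k, i.e. (v^(ℓ+1)_i)_j = (v^ℓ_i)_(j div k)
vvec : (k : ℕ) → (ℓ : ℕ) → (i : ℕ) → ℕ → ℚ
vvec k zero i j = 0ℚ  -- ℓ = 0 is not used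
vvec k (suc zero) i j =
  if j ≡ᵇ i then ℕtoℚ (k ∸ 1) * recip k else - recip k
vvec k (suc (suc ℓ)) i j = vvec k (suc ℓ) i (j / suc (k ∸ 1))

-- NB: for k ≥ 1, suc (k ∸ 1) = k; this avoids a NonZero instance on k.
-- Entry (r, t) of the benchmark matrix A (0-based row r, 0-based column
-- t = a*k + b with b ∈ {0..k-1}): column t is 1_{k^(α-a-1)} ⊗ v_b^(a+1),
-- whose r-th entry is (v_b^(a+1))_(r mod k^(a+1)).
entry : (k α : ℕ) → ℕ → ℕ → ℚ
entry k α r t =
  let k' = suc (k ∸ 1)
      a  = t / k'
      b  = t % k'
  in vvec k (suc a) b (_%_ r (k' ^ suc a) {{m^n≢0 k' (suc a)}})

row : (k α : ℕ) → Fin (k ^ α) → Fin (α ℕ.* k) → ℚ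
row k α r t = entry k α (toℕ r) (toℕ t)

inCluster : (k α : ℕ) → Fin α → Fin k → Fin (k ^ α) → Set
inCluster k α a j r = 0ℚ < entry k α (toℕ r) (toℕ a ℕ.* k ℕ.+ toℕ j)

inClusterᵇ : (k α : ℕ) → Fin α → Fin k → Fin (k ^ α) → ℚ
inClusterᵇ k α a j r =
  if ⌊ 0ℚ <? entry k α (toℕ r) (toℕ a ℕ.* k ℕ.+ toℕ j) ⌋ then ℚ.1ℚ else 0ℚ

clusterCard : (k α : ℕ) → Fin α → Fin k → ℕ
clusterCard zero α a ()
clusterCard (suc k) α a j = countFin (suc k ^ α)
  (λ r → ⌊ 0ℚ <? entry (suc k) α (toℕ r) (toℕ a ℕ.* suc k ℕ.+ toℕ j) ⌋)
  where
  open import Data.Bool using (Bool; true; false)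
  countFin : (n : ℕ) → (Fin n → Bool) → ℕ
  countFin zero p = zero
  countFin (suc n) p = (if p Fin.zero then 1 else 0) ℕ.+ countFin n (λ i → p (Fin.suc i))

mean : (k α : ℕ) → Fin α → Fin k → Fin (α ℕ.* k) → ℚ
mean k α a j t =
  recip (clusterCard k α a j) *
    sumFin (k ^ α) (λ r → inClusterᵇ k α a j r * row k α r t)

dist² : (d : ℕ) → (Fin d → ℚ) → (Fin d → ℚ) → ℚ
dist² d x y = sumFin d (λ t → (x t - y t) * (x t - y t))

module Submission where

-- Read the row index r in base k. Block a of the row A_r (columns a k, …, a k + k − 1) is
-- e_d − 𝟙/k, where d is the a-th digit of r, so C^a_j consists of the rows whose a-th digit
-- is j. Over all k^α rows the digits are independent and uniformly distributed, and the
-- coordinates of e_d − 𝟙/k sum to 0 over d; hence μ(C^a_h) equals e_h − 𝟙/k on block a and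
-- vanishes on every other block. The squared distance from A_r ∈ C^a_j to μ(C^a_h) is thus a
-- sum over the other blocks that does not depend on h, plus ‖e_j − e_h‖², which is 0 for
-- h = j and 2 otherwise.

open import Defs
open import Data.Nat using (ℕ; suc; NonZero)
open import Data.Fin using (Fin)

module NatToRational where
  open import Data.Nat as ℕ using (ℕ; zero; suc; NonZero)
  import Data.Nat.Properties as ℕₚ
  open import Data.Integer as ℤ using (+_)
  import Data.Integer.Properties as ℤₚ
  open import Data.Rational using (1ℚ; _+_; _*_; toℚᵘ)
  open import Data.Rational.Properties
  import Data.Rational.Unnormalised as ℚᵘ
  import Data.Rational.Unnormalised.Properties as ℚᵘₚ
  open import Relation.Binary.PropositionalEquality

  toℚᵘ-ℕtoℚ : ∀ n → toℚᵘ (ℕtoℚ n) ℚᵘ.≃ ℚᵘ.mkℚᵘ (+ n) 0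
  toℚᵘ-ℕtoℚ n = toℚᵘ-fromℚᵘ (ℚᵘ.mkℚᵘ (+ n) 0)

  mkℚᵘ-+ : ∀ m n → ℚᵘ.mkℚᵘ (+ (m ℕ.+ n)) 0 ℚᵘ.≃ ℚᵘ.mkℚᵘ (+ m) 0 ℚᵘ.+ ℚᵘ.mkℚᵘ (+ n) 0
  mkℚᵘ-+ m n = ℚᵘ.*≡* (begin
    + (m ℕ.+ n) ℤ.* + 1                   ≡⟨ ℤₚ.*-identityʳ _ ⟩
    + m ℤ.+ + n                           ≡⟨ cong₂ ℤ._+_ (ℤₚ.*-identityʳ (+ m)) (ℤₚ.*-identityʳ (+ n)) ⟨
    + m ℤ.* + 1 ℤ.+ + n ℤ.* + 1           ≡⟨ ℤₚ.*-identityʳ _ ⟨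
    (+ m ℤ.* + 1 ℤ.+ + n ℤ.* + 1) ℤ.* + 1 ∎)
    where open ≡-Reasoning

  ℕtoℚ-+ : ∀ m n → ℕtoℚ (m ℕ.+ n) ≡ ℕtoℚ m + ℕtoℚ n
  ℕtoℚ-+ m n = toℚᵘ-injective (begin-equality
    toℚᵘ (ℕtoℚ (m ℕ.+ n))                  ≃⟨ toℚᵘ-ℕtoℚ (m ℕ.+ n) ⟩
    ℚᵘ.mkℚᵘ (+ (m ℕ.+ n)) 0                ≃⟨ mkℚᵘ-+ m n ⟩
    ℚᵘ.mkℚᵘ (+ m) 0 ℚᵘ.+ ℚᵘ.mkℚᵘ (+ n) 0   ≃⟨ ℚᵘₚ.+-cong (toℚᵘ-ℕtoℚ m) (toℚᵘ-ℕtoℚ n) ⟨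
    toℚᵘ (ℕtoℚ m) ℚᵘ.+ toℚᵘ (ℕtoℚ n)       ≃⟨ toℚᵘ-homo-+ (ℕtoℚ m) (ℕtoℚ n) ⟨
    toℚᵘ (ℕtoℚ m + ℕtoℚ n)                 ∎)
    where open ℚᵘₚ.≤-Reasoning

  ℕtoℚ-* : ∀ m n → ℕtoℚ (m ℕ.* n) ≡ ℕtoℚ m * ℕtoℚ n
  ℕtoℚ-* zero    n = sym (*-zeroˡ (ℕtoℚ n))
  ℕtoℚ-* (suc m) n = begin
    ℕtoℚ (n ℕ.+ m ℕ.* n)                ≡⟨ ℕtoℚ-+ n (m ℕ.* n) ⟩
    ℕtoℚ n + ℕtoℚ (m ℕ.* n)             ≡⟨ cong₂ _+_ (sym (*-identityˡ (ℕtoℚ n))) (ℕtoℚ-* m n) ⟩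
    1ℚ * ℕtoℚ n + ℕtoℚ m * ℕtoℚ n       ≡⟨ *-distribʳ-+ (ℕtoℚ n) 1ℚ (ℕtoℚ m) ⟨
    (1ℚ + ℕtoℚ m) * ℕtoℚ n              ≡⟨ cong (_* ℕtoℚ n) (ℕtoℚ-+ 1 m) ⟨
    ℕtoℚ (suc m) * ℕtoℚ n               ∎
    where open ≡-Reasoning

  ℕtoℚ-injective : ∀ {m n} → ℕtoℚ m ≡ ℕtoℚ n → m ≡ n
  ℕtoℚ-injective {m} {n} eq =
    subst₂ _≡_ (ℕₚ.*-identityʳ m) (ℕₚ.*-identityʳ n) (normalize-injective-≃ m n 1 1 eq)

  mkℚᵘ-*-recip : ∀ m → ℚᵘ.mkℚᵘ (+ suc m) 0 ℚᵘ.* ℚᵘ.mkℚᵘ (+ 1) m ℚᵘ.≃ ℚᵘ.1ℚᵘ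
  mkℚᵘ-*-recip m = ℚᵘ.*≡* (begin
    (+ suc m ℤ.* + 1) ℤ.* + 1 ≡⟨ ℤₚ.*-identityʳ _ ⟩
    + suc m ℤ.* + 1           ≡⟨ ℤₚ.*-identityʳ _ ⟩
    + suc m                   ≡⟨ cong (λ x → + suc x) (ℕₚ.+-identityʳ m) ⟨
    + suc (m ℕ.+ 0)           ≡⟨ ℤₚ.*-identityˡ _ ⟨
    + 1 ℤ.* + suc (m ℕ.+ 0)   ∎)
    where open ≡-Reasoning

  ℕtoℚ-*-recip : ∀ n .{{_ : NonZero n}} → ℕtoℚ n * recip n ≡ 1ℚ
  ℕtoℚ-*-recip (suc m) = toℚᵘ-injective (begin-equality
    toℚᵘ (ℕtoℚ (suc m) * recip (suc m))           ≃⟨ toℚᵘ-homo-* (ℕtoℚ (suc m)) (recip (suc m)) ⟩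
    toℚᵘ (ℕtoℚ (suc m)) ℚᵘ.* toℚᵘ (recip (suc m)) ≃⟨ ℚᵘₚ.*-cong (toℚᵘ-ℕtoℚ (suc m)) (toℚᵘ-fromℚᵘ (ℚᵘ.mkℚᵘ (+ 1) m)) ⟩
    ℚᵘ.mkℚᵘ (+ suc m) 0 ℚᵘ.* ℚᵘ.mkℚᵘ (+ 1) m      ≃⟨ mkℚᵘ-*-recip m ⟩
    ℚᵘ.1ℚᵘ                                        ∎)
    where open ℚᵘₚ.≤-Reasoning

  recip-cancelˡ : ∀ n .{{_ : NonZero n}} x → recip n * (ℕtoℚ n * x) ≡ x
  recip-cancelˡ n x = begin
    recip n * (ℕtoℚ n * x) ≡⟨ *-assoc (recip n) (ℕtoℚ n) x ⟨
    recip n * ℕtoℚ n * x   ≡⟨ cong (_* x) (*-comm (recip n) (ℕtoℚ n)) ⟩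
    ℕtoℚ n * recip n * x   ≡⟨ cong (_* x) (ℕtoℚ-*-recip n) ⟩
    1ℚ * x                 ≡⟨ *-identityˡ x ⟩
    x                      ∎
    where open ≡-Reasoning

module FiniteSums where
  open import Data.Nat as ℕ using (ℕ; zero; suc; _≡ᵇ_; _<_; z≤n; s≤s)
  import Data.Nat.Properties as ℕₚ
  open import Data.Bool using (Bool; true; false; T; if_then_else_)
  open import Data.Fin as Fin using (Fin; toℕ)
  open import Data.Rational using (ℚ; 0ℚ; 1ℚ; _+_; _*_; _-_; _≤_)
  open import Data.Rational.Properties
  open import Relation.Nullary using (contradiction)
  open import Algebra.Bundles using (CommutativeMonoid)
  open import Algebra.Properties.CommutativeSemigroup
    (CommutativeMonoid.commutativeSemigroup +-0-commutativeMonoid) using (interchange)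
  open import Relation.Binary.PropositionalEquality
  open NatToRational

  ∑ : ℕ → (ℕ → ℚ) → ℚ
  ∑ zero    f = 0ℚ
  ∑ (suc n) f = f 0 + ∑ n (λ i → f (suc i))

  sumFin-toℕ : ∀ n (f : ℕ → ℚ) → sumFin n (λ i → f (toℕ i)) ≡ ∑ n f
  sumFin-toℕ zero    f = refl
  sumFin-toℕ (suc n) f = cong (f 0 +_) (sumFin-toℕ n (λ i → f (suc i)))

  ∑-cong : ∀ n {f g : ℕ → ℚ} → (∀ i → i < n → f i ≡ g i) → ∑ n f ≡ ∑ n g
  ∑-cong zero    eq = refl
  ∑-cong (suc n) eq = cong₂ _+_ (eq 0 (s≤s z≤n)) (∑-cong n (λ i i<n → eq (suc i) (s≤s i<n)))

  ∑-mono-≤ : ∀ n {f g : ℕ → ℚ} → (∀ i → i < n → f i ≤ g i) → ∑ n f ≤ ∑ n g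
  ∑-mono-≤ zero    le = ≤-refl
  ∑-mono-≤ (suc n) le = +-mono-≤ (le 0 (s≤s z≤n)) (∑-mono-≤ n (λ i i<n → le (suc i) (s≤s i<n)))

  ∑-distrib-+ : ∀ n (f g : ℕ → ℚ) → ∑ n (λ i → f i + g i) ≡ ∑ n f + ∑ n g
  ∑-distrib-+ zero    f g = refl
  ∑-distrib-+ (suc n) f g =
    trans (cong (f 0 + g 0 +_) (∑-distrib-+ n (λ i → f (suc i)) (λ i → g (suc i))))
          (interchange (f 0) (g 0) (∑ n (λ i → f (suc i))) (∑ n (λ i → g (suc i))))

  *-distribˡ-∑ : ∀ n c (f : ℕ → ℚ) → c * ∑ n f ≡ ∑ n (λ i → c * f i)
  *-distribˡ-∑ zero    c f = *-zeroʳ c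
  *-distribˡ-∑ (suc n) c f = trans (*-distribˡ-+ c (f 0) _) (cong (c * f 0 +_) (*-distribˡ-∑ n c (λ i → f (suc i))))

  *-distribʳ-∑ : ∀ n c (f : ℕ → ℚ) → ∑ n f * c ≡ ∑ n (λ i → f i * c)
  *-distribʳ-∑ zero    c f = *-zeroˡ c
  *-distribʳ-∑ (suc n) c f = trans (*-distribʳ-+ c (f 0) _) (cong (f 0 * c +_) (*-distribʳ-∑ n c (λ i → f (suc i))))

  ∑-const : ∀ n x → ∑ n (λ _ → x) ≡ ℕtoℚ n * x
  ∑-const zero    x = sym (*-zeroˡ x)
  ∑-const (suc n) x = begin
    x + ∑ n (λ _ → x)     ≡⟨ cong₂ _+_ (sym (*-identityˡ x)) (∑-const n x) ⟩
    1ℚ * x + ℕtoℚ n * x   ≡⟨ *-distribʳ-+ x 1ℚ (ℕtoℚ n) ⟨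
    (1ℚ + ℕtoℚ n) * x     ≡⟨ cong (_* x) (ℕtoℚ-+ 1 n) ⟨
    ℕtoℚ (suc n) * x      ∎
    where open ≡-Reasoning

  ∑-zero : ∀ n → ∑ n (λ _ → 0ℚ) ≡ 0ℚ
  ∑-zero n = trans (∑-const n 0ℚ) (*-zeroʳ (ℕtoℚ n))

  ∑-split : ∀ m n (f : ℕ → ℚ) → ∑ (m ℕ.+ n) f ≡ ∑ m f + ∑ n (λ i → f (m ℕ.+ i))
  ∑-split zero    n f = sym (+-identityˡ _)
  ∑-split (suc m) n f = trans (cong (f 0 +_) (∑-split m n (λ i → f (suc i)))) (sym (+-assoc (f 0) _ _))

  ∑-blocks : ∀ m k (f : ℕ → ℚ) → ∑ (m ℕ.* k) f ≡ ∑ m (λ s → ∑ k (λ q → f (s ℕ.* k ℕ.+ q)))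
  ∑-blocks zero    k f = refl
  ∑-blocks (suc m) k f = begin
    ∑ (k ℕ.+ m ℕ.* k) f                                        ≡⟨ ∑-split k (m ℕ.* k) f ⟩
    ∑ k f + ∑ (m ℕ.* k) (λ i → f (k ℕ.+ i))                    ≡⟨ cong (∑ k f +_) (∑-blocks m k (λ i → f (k ℕ.+ i))) ⟩
    ∑ k f + ∑ m (λ s → ∑ k (λ q → f (k ℕ.+ (s ℕ.* k ℕ.+ q))))  ≡⟨ cong (∑ k f +_) (∑-cong m (λ s _ → ∑-cong k (λ q _ →
                                                                      cong f (sym (ℕₚ.+-assoc k (s ℕ.* k) q))))) ⟩
    ∑ k f + ∑ m (λ s → ∑ k (λ q → f (suc s ℕ.* k ℕ.+ q)))      ∎
    where open ≡-Reasoning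

  δ : ℕ → ℕ → ℚ
  δ i j = if i ≡ᵇ j then 1ℚ else 0ℚ

  δ-sym : ∀ i j → δ i j ≡ δ j i
  δ-sym zero    zero    = refl
  δ-sym zero    (suc j) = refl
  δ-sym (suc i) zero    = refl
  δ-sym (suc i) (suc j) = δ-sym i j

  ≡ᵇ-true⇒≡ : ∀ {m n} → (m ≡ᵇ n) ≡ true → m ≡ n
  ≡ᵇ-true⇒≡ {m} {n} eq = ℕₚ.≡ᵇ⇒≡ m n (subst T (sym eq) _)

  δ-subst : ∀ i j (f : ℕ → ℚ) → δ i j * f i ≡ δ i j * f j
  δ-subst i j f with i ≡ᵇ j in i≡ᵇj
  ... | true  = cong (λ x → 1ℚ * f x) (≡ᵇ-true⇒≡ i≡ᵇj)
  ... | false = trans (*-zeroˡ (f i)) (sym (*-zeroˡ (f j)))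

  δ-diff² : ∀ b d e → d ≢ e → (δ d b - δ e b) * (δ d b - δ e b) ≡ δ d b + δ e b
  δ-diff² b d e d≢e with d ≡ᵇ b in d≡ᵇb | e ≡ᵇ b in e≡ᵇb
  ... | true  | true  = contradiction (trans (≡ᵇ-true⇒≡ d≡ᵇb) (sym (≡ᵇ-true⇒≡ e≡ᵇb))) d≢e
  ... | true  | false = refl
  ... | false | true  = refl
  ... | false | false = refl

  ∑-δ : ∀ n j → j < n → ∑ n (λ i → δ i j) ≡ 1ℚ
  ∑-δ (suc n) zero    _         = trans (cong (1ℚ +_) (∑-zero n)) (+-identityʳ 1ℚ)
  ∑-δ (suc n) (suc j) (s≤s j<n) = trans (+-identityˡ _) (∑-δ n j j<n)

  count : (n : ℕ) → (Fin n → Bool) → ℕ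
  count zero    p = zero
  count (suc n) p = (if p Fin.zero then 1 else 0) ℕ.+ count n (λ i → p (Fin.suc i))

  count-unique : {F : (n : ℕ) → (Fin n → Bool) → ℕ} →
                 (∀ p → F 0 p ≡ 0) →
                 (∀ n p → F (suc n) p ≡ (if p Fin.zero then 1 else 0) ℕ.+ F n (λ i → p (Fin.suc i))) →
                 ∀ n p → F n p ≡ count n p
  count-unique         F-zero F-suc zero    p = F-zero p
  count-unique {F = F} F-zero F-suc (suc n) p =
    trans (F-suc n p) (cong ((if p Fin.zero then 1 else 0) ℕ.+_) (count-unique {F = F} F-zero F-suc n (λ i → p (Fin.suc i))))

  ℕtoℚ-count : ∀ n (p : ℕ → Bool) → ℕtoℚ (count n (λ i → p (toℕ i))) ≡ ∑ n (λ i → if p i then 1ℚ else 0ℚ)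
  ℕtoℚ-count zero    p = refl
  ℕtoℚ-count (suc n) p = trans (ℕtoℚ-+ (if p 0 then 1 else 0) _) (cong₂ _+_ (indicator (p 0)) (ℕtoℚ-count n (λ i → p (suc i))))
    where
    indicator : ∀ b → ℕtoℚ (if b then 1 else 0) ≡ (if b then 1ℚ else 0ℚ)
    indicator true  = refl
    indicator false = refl

module Digits (k : ℕ) .{{_ : NonZero k}} where
  open import Data.Nat as ℕ using (ℕ; zero; suc; _<_; _≤_; _^_; z≤n; s≤s; NonZero)
  import Data.Nat.Properties as ℕₚ
  open import Data.Nat.DivMod
  open import Data.Nat.Divisibility using (divides-refl)
  open import Data.Rational using (ℚ; 0ℚ; _*_)
  open import Data.Rational.Properties
  open import Relation.Binary.PropositionalEquality
  open import Relation.Nullary using (contradiction)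
  open import Function using (_∘_)
  open NatToRational
  open FiniteSums

  k^-nonZero : ∀ a → NonZero (k ^ a)
  k^-nonZero a = ℕₚ.m^n≢0 k a

  dig : ℕ → ℕ → ℕ
  dig a r = (r / k ^ a) {{k^-nonZero a}} % k

  [s*k+q]%k≡q : ∀ s {q} → q < k → (s ℕ.* k ℕ.+ q) % k ≡ q
  [s*k+q]%k≡q s {q} q<k = trans (%-remove-+ˡ q (divides-refl s)) (m<n⇒m%n≡m q<k)

  [s*k+q]/k≡s : ∀ s {q} → q < k → (s ℕ.* k ℕ.+ q) / k ≡ s
  [s*k+q]/k≡s s {q} q<k = begin
    (s ℕ.* k ℕ.+ q) / k      ≡⟨ +-distrib-/-∣ˡ q (divides-refl s) ⟩
    s ℕ.* k / k ℕ.+ q / k    ≡⟨ cong₂ ℕ._+_ (m*n/n≡m s k) (m<n⇒m/n≡0 q<k) ⟩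
    s ℕ.+ 0                  ≡⟨ ℕₚ.+-identityʳ s ⟩
    s                        ∎
    where open ≡-Reasoning

  dig-zero : ∀ r → dig 0 r ≡ r % k
  dig-zero r = cong (_% k) (n/1≡n r)

  dig-suc : ∀ a r → dig (suc a) r ≡ dig a (r / k)
  dig-suc a r = cong (_% k) (sym (m/n/o≡m/[n*o] r k (k ^ a) {{_}} {{k^-nonZero a}} {{k^-nonZero (suc a)}}))

  ∑-lowestDigit : ∀ m (g : ℕ → ℕ → ℚ) →
                  ∑ (k ^ suc m) (λ r → g (r % k) (r / k)) ≡ ∑ (k ^ m) (λ s → ∑ k (λ q → g q s))
  ∑-lowestDigit m g = begin
    ∑ (k ^ suc m) (λ r → g (r % k) (r / k))                                  ≡⟨ cong (λ n → ∑ n (λ r → g (r % k) (r / k))) (ℕₚ.*-comm k (k ^ m)) ⟩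
    ∑ (k ^ m ℕ.* k) (λ r → g (r % k) (r / k))                                ≡⟨ ∑-blocks (k ^ m) k (λ r → g (r % k) (r / k)) ⟩
    ∑ (k ^ m) (λ s → ∑ k (λ q → g ((s ℕ.* k ℕ.+ q) % k) ((s ℕ.* k ℕ.+ q) / k))) ≡⟨ ∑-cong (k ^ m) (λ s _ → ∑-cong k (λ q q<k →
                                                                                  cong₂ g ([s*k+q]%k≡q s q<k) ([s*k+q]/k≡s s q<k))) ⟩
    ∑ (k ^ m) (λ s → ∑ k (λ q → g q s))                                      ∎
    where open ≡-Reasoning

  ∑-digit : ∀ m a → a ≤ m → (φ : ℕ → ℚ) → ∑ (k ^ suc m) (λ r → φ (dig a r)) ≡ ℕtoℚ (k ^ m) * ∑ k φ
  ∑-digit m zero z≤n φ = begin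
    ∑ (k ^ suc m) (λ r → φ (dig 0 r))  ≡⟨ ∑-cong (k ^ suc m) (λ r _ → cong φ (dig-zero r)) ⟩
    ∑ (k ^ suc m) (λ r → φ (r % k))    ≡⟨ ∑-lowestDigit m (λ q _ → φ q) ⟩
    ∑ (k ^ m) (λ _ → ∑ k φ)            ≡⟨ ∑-const (k ^ m) (∑ k φ) ⟩
    ℕtoℚ (k ^ m) * ∑ k φ               ∎
    where open ≡-Reasoning
  ∑-digit (suc m) (suc a) (s≤s a≤m) φ = begin
    ∑ (k ^ suc (suc m)) (λ r → φ (dig (suc a) r))  ≡⟨ ∑-cong (k ^ suc (suc m)) (λ r _ → cong φ (dig-suc a r)) ⟩
    ∑ (k ^ suc (suc m)) (λ r → φ (dig a (r / k)))  ≡⟨ ∑-lowestDigit (suc m) (λ _ s → φ (dig a s)) ⟩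
    ∑ (k ^ suc m) (λ s → ∑ k (λ _ → φ (dig a s)))  ≡⟨ ∑-cong (k ^ suc m) (λ s _ → ∑-const k (φ (dig a s))) ⟩
    ∑ (k ^ suc m) (λ s → ℕtoℚ k * φ (dig a s))     ≡⟨ *-distribˡ-∑ (k ^ suc m) (ℕtoℚ k) (λ s → φ (dig a s)) ⟨
    ℕtoℚ k * ∑ (k ^ suc m) (λ s → φ (dig a s))     ≡⟨ cong (ℕtoℚ k *_) (∑-digit m a a≤m φ) ⟩
    ℕtoℚ k * (ℕtoℚ (k ^ m) * ∑ k φ)                ≡⟨ *-assoc (ℕtoℚ k) (ℕtoℚ (k ^ m)) (∑ k φ) ⟨
    ℕtoℚ k * ℕtoℚ (k ^ m) * ∑ k φ                  ≡⟨ cong (_* ∑ k φ) (ℕtoℚ-* k (k ^ m)) ⟨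
    ℕtoℚ (k ^ suc m) * ∑ k φ                       ∎
    where open ≡-Reasoning

  ∑-digit-vanish : ∀ m a → a < m → (φ : ℕ → ℚ) → ∑ k φ ≡ 0ℚ → ∑ (k ^ m) (λ r → φ (dig a r)) ≡ 0ℚ
  ∑-digit-vanish (suc m) a (s≤s a≤m) φ ∑φ≡0 =
    trans (∑-digit m a a≤m φ) (trans (cong (ℕtoℚ (k ^ m) *_) ∑φ≡0) (*-zeroʳ (ℕtoℚ (k ^ m))))

  ∑-digits-orthogonal : ∀ m a b → a ≢ b → a < m → b < m → (f φ : ℕ → ℚ) → ∑ k φ ≡ 0ℚ →
                        ∑ (k ^ m) (λ r → f (dig a r) * φ (dig b r)) ≡ 0ℚ
  ∑-digits-orthogonal (suc m) zero zero 0≢0 _ _ f φ ∑φ≡0 = contradiction refl 0≢0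
  ∑-digits-orthogonal (suc m) zero (suc b) _ _ (s≤s b<m) f φ ∑φ≡0 = begin
    ∑ (k ^ suc m) (λ r → f (dig 0 r) * φ (dig (suc b) r))  ≡⟨ ∑-cong (k ^ suc m) (λ r _ →
                                                                 cong₂ (λ x y → f x * φ y) (dig-zero r) (dig-suc b r)) ⟩
    ∑ (k ^ suc m) (λ r → f (r % k) * φ (dig b (r / k)))   ≡⟨ ∑-lowestDigit m (λ q s → f q * φ (dig b s)) ⟩
    ∑ (k ^ m) (λ s → ∑ k (λ q → f q * φ (dig b s)))       ≡⟨ ∑-cong (k ^ m) (λ s _ → *-distribʳ-∑ k (φ (dig b s)) f) ⟨
    ∑ (k ^ m) (λ s → ∑ k f * φ (dig b s))                 ≡⟨ *-distribˡ-∑ (k ^ m) (∑ k f) (λ s → φ (dig b s)) ⟨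
    ∑ k f * ∑ (k ^ m) (λ s → φ (dig b s))                 ≡⟨ cong (∑ k f *_) (∑-digit-vanish m b b<m φ ∑φ≡0) ⟩
    ∑ k f * 0ℚ                                            ≡⟨ *-zeroʳ (∑ k f) ⟩
    0ℚ                                                    ∎
    where open ≡-Reasoning
  ∑-digits-orthogonal (suc m) (suc a) zero _ _ _ f φ ∑φ≡0 = begin
    ∑ (k ^ suc m) (λ r → f (dig (suc a) r) * φ (dig 0 r))  ≡⟨ ∑-cong (k ^ suc m) (λ r _ →
                                                                 cong₂ (λ x y → f x * φ y) (dig-suc a r) (dig-zero r)) ⟩
    ∑ (k ^ suc m) (λ r → f (dig a (r / k)) * φ (r % k))   ≡⟨ ∑-lowestDigit m (λ q s → f (dig a s) * φ q) ⟩
    ∑ (k ^ m) (λ s → ∑ k (λ q → f (dig a s) * φ q))       ≡⟨ ∑-cong (k ^ m) (λ s _ → *-distribˡ-∑ k (f (dig a s)) φ) ⟨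
    ∑ (k ^ m) (λ s → f (dig a s) * ∑ k φ)                 ≡⟨ ∑-cong (k ^ m) (λ s _ → trans (cong (f (dig a s) *_) ∑φ≡0) (*-zeroʳ (f (dig a s)))) ⟩
    ∑ (k ^ m) (λ _ → 0ℚ)                                  ≡⟨ ∑-zero (k ^ m) ⟩
    0ℚ                                                    ∎
    where open ≡-Reasoning
  ∑-digits-orthogonal (suc m) (suc a) (suc b) 1+a≢1+b (s≤s a<m) (s≤s b<m) f φ ∑φ≡0 = begin
    ∑ (k ^ suc m) (λ r → f (dig (suc a) r) * φ (dig (suc b) r))  ≡⟨ ∑-cong (k ^ suc m) (λ r _ →
                                                                       cong₂ (λ x y → f x * φ y) (dig-suc a r) (dig-suc b r)) ⟩
    ∑ (k ^ suc m) (λ r → f (dig a (r / k)) * φ (dig b (r / k)))  ≡⟨ ∑-lowestDigit m (λ _ s → f (dig a s) * φ (dig b s)) ⟩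
    ∑ (k ^ m) (λ s → ∑ k (λ _ → f (dig a s) * φ (dig b s)))      ≡⟨ ∑-cong (k ^ m) (λ s _ → ∑-const k (f (dig a s) * φ (dig b s))) ⟩
    ∑ (k ^ m) (λ s → ℕtoℚ k * (f (dig a s) * φ (dig b s)))       ≡⟨ *-distribˡ-∑ (k ^ m) (ℕtoℚ k) (λ s → f (dig a s) * φ (dig b s)) ⟨
    ℕtoℚ k * ∑ (k ^ m) (λ s → f (dig a s) * φ (dig b s))         ≡⟨ cong (ℕtoℚ k *_)
                                                                       (∑-digits-orthogonal m a b (1+a≢1+b ∘ cong suc) a<m b<m f φ ∑φ≡0) ⟩
    ℕtoℚ k * 0ℚ                                                  ≡⟨ *-zeroʳ (ℕtoℚ k) ⟩
    0ℚ                                                           ∎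
    where open ≡-Reasoning

module Benchmark (K : ℕ) where
  open import Data.Nat as ℕ using (zero; suc; _≡ᵇ_; _^_)
  import Data.Nat.Properties as ℕₚ
  open import Data.Nat.DivMod
  open import Data.Bool using (true; false; T; if_then_else_)
  open import Data.Rational using (ℚ; 0ℚ; 1ℚ; _+_; _*_; _-_; -_; _≤_; _<_; _<?_)
  open import Data.Rational.Properties
  open import Data.Rational.Solver using (module +-*-Solver)
  open import Relation.Binary.PropositionalEquality
  open import Relation.Nullary using (yes; no)
  open import Relation.Nullary.Decidable using (⌊_⌋; isYes≗does; dec-true; dec-false; fromWitness)
  open NatToRational
  open FiniteSums

  k : ℕ
  k = suc (suc K)

  open Digits k

  v¹ : ℕ → ℕ → ℚ
  v¹ = vvec k 1

  [k-1]/k≡1-1/k : ℕtoℚ (suc K) * recip k ≡ 1ℚ - recip k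
  [k-1]/k≡1-1/k = begin
    x * r                   ≡⟨ solve 2 (λ x r → x :* r := (con 1ℚ :+ x) :* r :- r) refl x r ⟩
    (1ℚ + x) * r - r        ≡⟨ cong (λ y → y * r - r) (ℕtoℚ-+ 1 (suc K)) ⟨
    ℕtoℚ k * r - r          ≡⟨ cong (_- r) (ℕtoℚ-*-recip k) ⟩
    1ℚ - r                  ∎
    where
    open ≡-Reasoning
    open +-*-Solver
    x = ℕtoℚ (suc K)
    r = recip k

  0<[k-1]/k : 0ℚ < ℕtoℚ (suc K) * recip k
  0<[k-1]/k = positive⁻¹ _ {{pos*pos⇒pos (ℕtoℚ (suc K)) {{normalize-pos (suc K) 1}} (recip k) {{normalize-pos 1 k}}}}

  -1/k<0 : - recip k < 0ℚ
  -1/k<0 = negative⁻¹ _ {{neg-pos {recip k} (normalize-pos 1 k)}}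

  v¹-δ : ∀ b d → v¹ b d ≡ δ d b - recip k
  v¹-δ b d with d ≡ᵇ b
  ... | true  = [k-1]/k≡1-1/k
  ... | false = sym (+-identityˡ (- recip k))

  ∑-v¹ : ∀ b → b ℕ.< k → ∑ k (λ d → v¹ b d) ≡ 0ℚ
  ∑-v¹ b b<k = begin
    ∑ k (λ d → v¹ b d)                  ≡⟨ ∑-cong k (λ d _ → v¹-δ b d) ⟩
    ∑ k (λ d → δ d b - recip k)         ≡⟨ ∑-distrib-+ k (λ d → δ d b) (λ _ → - recip k) ⟩
    ∑ k (λ d → δ d b) + ∑ k (λ _ → - recip k)  ≡⟨ cong₂ _+_ (∑-δ k b b<k) (∑-const k (- recip k)) ⟩
    1ℚ + ℕtoℚ k * - recip k             ≡⟨ cong (1ℚ +_) (neg-distribʳ-* (ℕtoℚ k) (recip k)) ⟨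
    1ℚ - ℕtoℚ k * recip k               ≡⟨ cong (λ x → 1ℚ - x) (ℕtoℚ-*-recip k) ⟩
    1ℚ - 1ℚ                             ≡⟨ +-inverseʳ 1ℚ ⟩
    0ℚ                                  ∎
    where open ≡-Reasoning

  v¹-positive? : ∀ b d → ⌊ 0ℚ <? v¹ b d ⌋ ≡ (d ≡ᵇ b)
  v¹-positive? b d = positive-iff (d ≡ᵇ b)
    where
    positive-iff : ∀ c → ⌊ 0ℚ <? (if c then ℕtoℚ (suc K) * recip k else - recip k) ⌋ ≡ c
    positive-iff true  = trans (isYes≗does (0ℚ <? _)) (dec-true (0ℚ <? _) 0<[k-1]/k)
    positive-iff false = trans (isYes≗does (0ℚ <? _)) (dec-false (0ℚ <? _) (λ 0<-1/k → <-asym 0<-1/k -1/k<0))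

  v¹-positive⇒≡ : ∀ b d → 0ℚ < v¹ b d → d ≡ b
  v¹-positive⇒≡ b d 0<v = ℕₚ.≡ᵇ⇒≡ d b (subst T (v¹-positive? b d) (fromWitness 0<v))

  vvec-v¹ : ∀ a b x → vvec k (suc a) b x ≡ v¹ b ((x / k ^ a) {{k^-nonZero a}})
  vvec-v¹ zero    b x = cong (v¹ b) (sym (n/1≡n x))
  vvec-v¹ (suc a) b x = trans (vvec-v¹ a b (x / k))
    (cong (v¹ b) (m/n/o≡m/[n*o] x k (k ^ a) {{_}} {{k^-nonZero a}} {{k^-nonZero (suc a)}}))

  entry-v¹ : ∀ α r a b → b ℕ.< k → entry k α r (a ℕ.* k ℕ.+ b) ≡ v¹ b (dig a r)
  entry-v¹ α r a b b<k = begin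
    entry k α r (a ℕ.* k ℕ.+ b)             ≡⟨ cong₂ (λ a′ b′ → vvec k (suc a′) b′ (_%_ r (k ^ suc a′) {{k^-nonZero (suc a′)}}))
                                                 ([s*k+q]/k≡s a b<k) ([s*k+q]%k≡q a b<k) ⟩
    vvec k (suc a) b (_%_ r (k ^ suc a) {{k^-nonZero (suc a)}}) ≡⟨ vvec-v¹ a b _ ⟩
    v¹ b (_/_ (_%_ r (k ^ suc a) {{k^-nonZero (suc a)}}) (k ^ a) {{k^-nonZero a}})
                                            ≡⟨ cong (v¹ b) (m%[n*o]/o≡m/o%n r k (k ^ a) {{_}} {{k^-nonZero a}} {{k^-nonZero (suc a)}}) ⟩
    v¹ b (dig a r)                          ∎
    where open ≡-Reasoning

  v¹-dist² : ℕ → ℕ → ℚ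
  v¹-dist² d e = ∑ k (λ b → (v¹ b d - v¹ b e) * (v¹ b d - v¹ b e))

  v¹-dist²-self : ∀ d → v¹-dist² d d ≡ 0ℚ
  v¹-dist²-self d = trans (∑-cong k (λ b _ → cong (λ x → x * x) (+-inverseʳ (v¹ b d)))) (∑-zero k)

  v¹-diff : ∀ b d e → v¹ b d - v¹ b e ≡ δ d b - δ e b
  v¹-diff b d e = trans (cong₂ _-_ (v¹-δ b d) (v¹-δ b e))
                       (solve 3 (λ x y r → (x :- r) :- (y :- r) := x :- y) refl (δ d b) (δ e b) (recip k))
    where open +-*-Solver

  v¹-dist²-distinct : ∀ d e → d ≢ e → d ℕ.< k → e ℕ.< k → v¹-dist² d e ≡ 1ℚ + 1ℚ
  v¹-dist²-distinct d e d≢e d<k e<k = begin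
    v¹-dist² d e                              ≡⟨ ∑-cong k (λ b _ → trans (cong (λ x → x * x) (v¹-diff b d e)) (δ-diff² b d e d≢e)) ⟩
    ∑ k (λ b → δ d b + δ e b)                 ≡⟨ ∑-distrib-+ k (δ d) (δ e) ⟩
    ∑ k (λ b → δ d b) + ∑ k (λ b → δ e b)     ≡⟨ cong₂ _+_ (∑-cong k (λ b _ → δ-sym d b)) (∑-cong k (λ b _ → δ-sym e b)) ⟩
    ∑ k (λ b → δ b d) + ∑ k (λ b → δ b e)     ≡⟨ cong₂ _+_ (∑-δ k d d<k) (∑-δ k e e<k) ⟩
    1ℚ + 1ℚ                                   ∎
    where open ≡-Reasoning

  v¹-dist²-nonNeg : ∀ d e → d ℕ.< k → e ℕ.< k → 0ℚ ≤ v¹-dist² d e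
  v¹-dist²-nonNeg d e d<k e<k with d ℕ.≟ e
  ... | yes refl = ≤-reflexive (sym (v¹-dist²-self d))
  ... | no  d≢e  = subst (0ℚ ≤_) (sym (v¹-dist²-distinct d e d≢e d<k e<k)) (nonNegative⁻¹ (1ℚ + 1ℚ))

module Clusters (K α′ : ℕ) (a : Fin (suc α′)) where
  open import Data.Nat as ℕ using (suc; _^_)
  open import Data.Bool using (if_then_else_)
  open import Data.Fin using (toℕ)
  open import Data.Fin.Properties using (toℕ<n; toℕ-injective)
  open import Data.Rational using (ℚ; 0ℚ; 1ℚ; _+_; _*_; _-_; _≤_; _<_; _<?_)
  open import Data.Rational.Properties
  open import Relation.Binary.PropositionalEquality
  open import Relation.Nullary using (yes; no)
  open import Function using (_∘_)
  open import Relation.Nullary.Decidable using (⌊_⌋)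
  open NatToRational
  open FiniteSums
  open Benchmark K
  open Digits k

  α A : ℕ
  α = suc α′
  A = toℕ a

  A<α : A ℕ.< α
  A<α = toℕ<n a

  cluster-indicator : ∀ r h → h ℕ.< k →
                      (if ⌊ 0ℚ <? entry k α r (A ℕ.* k ℕ.+ h) ⌋ then 1ℚ else 0ℚ) ≡ δ (dig A r) h
  cluster-indicator r h h<k = cong (λ c → if c then 1ℚ else 0ℚ)
    (trans (cong (λ x → ⌊ 0ℚ <? x ⌋) (entry-v¹ α r A h h<k)) (v¹-positive? h (dig A r)))

  ∑-cluster : ∀ h → h ℕ.< k → ∑ (k ^ α) (λ r → δ (dig A r) h) ≡ ℕtoℚ (k ^ α′)
  ∑-cluster h h<k = begin
    ∑ (k ^ α) (λ r → δ (dig A r) h)  ≡⟨ ∑-digit α′ A (ℕ.s≤s⁻¹ A<α) (λ d → δ d h) ⟩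
    ℕtoℚ (k ^ α′) * ∑ k (λ d → δ d h) ≡⟨ cong (ℕtoℚ (k ^ α′) *_) (∑-δ k h h<k) ⟩
    ℕtoℚ (k ^ α′) * 1ℚ                ≡⟨ *-identityʳ (ℕtoℚ (k ^ α′)) ⟩
    ℕtoℚ (k ^ α′)                     ∎
    where open ≡-Reasoning

  clusterCard-count : ∀ h → clusterCard k α a h ≡
                      count (k ^ α) (λ r → ⌊ 0ℚ <? entry k α (toℕ r) (A ℕ.* k ℕ.+ toℕ h) ⌋)
  clusterCard-count h = generalised
    where
    -- The hole is the counting function local to clusterCard, which cannot be named; it is
    -- found by unification with the goal once k ^ α and the predicate are generalised.
    counted : ∀ n p → _ ≡ count n p
    counted = count-unique (λ _ → refl) (λ _ _ → refl)
    generalised : clusterCard k α a h ≡ count (k ^ α) (λ r → ⌊ 0ℚ <? entry k α (toℕ r) (A ℕ.* k ℕ.+ toℕ h) ⌋)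
    generalised with k ^ α | (λ (r : Fin (k ^ α)) → ⌊ 0ℚ <? entry k α (toℕ r) (A ℕ.* k ℕ.+ toℕ h) ⌋)
    ... | n | p = counted n p

  clusterCard≡ : ∀ h → clusterCard k α a h ≡ k ^ α′
  clusterCard≡ h = ℕtoℚ-injective (begin
    ℕtoℚ (clusterCard k α a h)                                            ≡⟨ cong ℕtoℚ (clusterCard-count h) ⟩
    ℕtoℚ (count (k ^ α) (λ r → ⌊ 0ℚ <? entry k α (toℕ r) (A ℕ.* k ℕ.+ H) ⌋)) ≡⟨ ℕtoℚ-count (k ^ α) _ ⟩
    ∑ (k ^ α) (λ r → if ⌊ 0ℚ <? entry k α r (A ℕ.* k ℕ.+ H) ⌋ then 1ℚ else 0ℚ) ≡⟨ ∑-cong (k ^ α) (λ r _ → cluster-indicator r H (toℕ<n h)) ⟩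
    ∑ (k ^ α) (λ r → δ (dig A r) H)                                       ≡⟨ ∑-cluster H (toℕ<n h) ⟩
    ℕtoℚ (k ^ α′)                                                         ∎)
    where
    open ≡-Reasoning
    H = toℕ h

  -- mean k α a h t reduces to center h (toℕ t).
  center : Fin k → ℕ → ℚ
  center h t = recip (clusterCard k α a h) * sumFin (k ^ α) (λ r → inClusterᵇ k α a h r * entry k α (toℕ r) t)

  center-∑ : ∀ h t → center h t ≡ recip (k ^ α′) * ∑ (k ^ α) (λ r → δ (dig A r) (toℕ h) * entry k α r t)
  center-∑ h t = cong₂ _*_ (cong recip (clusterCard≡ h))
    (trans (sumFin-toℕ (k ^ α) (λ r → (if ⌊ 0ℚ <? entry k α r (A ℕ.* k ℕ.+ toℕ h) ⌋ then 1ℚ else 0ℚ) * entry k α r t))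
           (∑-cong (k ^ α) (λ r _ → cong (_* entry k α r t) (cluster-indicator r (toℕ h) (toℕ<n h)))))

  center-own-block : ∀ h b → b ℕ.< k → center h (A ℕ.* k ℕ.+ b) ≡ v¹ b (toℕ h)
  center-own-block h b b<k = begin
    center h (A ℕ.* k ℕ.+ b)                                            ≡⟨ center-∑ h (A ℕ.* k ℕ.+ b) ⟩
    recip (k ^ α′) * ∑ (k ^ α) (λ r → δ (dig A r) H * entry k α r (A ℕ.* k ℕ.+ b))
                                                                        ≡⟨ cong (recip (k ^ α′) *_) (∑-cong (k ^ α) (λ r _ →
                                                                             trans (cong (δ (dig A r) H *_) (entry-v¹ α r A b b<k))
                                                                                   (δ-subst (dig A r) H (v¹ b)))) ⟩
    recip (k ^ α′) * ∑ (k ^ α) (λ r → δ (dig A r) H * v¹ b H)           ≡⟨ cong (recip (k ^ α′) *_) (*-distribʳ-∑ (k ^ α) (v¹ b H) (λ r → δ (dig A r) H)) ⟨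
    recip (k ^ α′) * (∑ (k ^ α) (λ r → δ (dig A r) H) * v¹ b H)         ≡⟨ cong (λ x → recip (k ^ α′) * (x * v¹ b H)) (∑-cluster H (toℕ<n h)) ⟩
    recip (k ^ α′) * (ℕtoℚ (k ^ α′) * v¹ b H)                           ≡⟨ recip-cancelˡ (k ^ α′) {{k^-nonZero α′}} (v¹ b H) ⟩
    v¹ b H                                                              ∎
    where
    open ≡-Reasoning
    H = toℕ h

  center-other-block : ∀ h a′ b → a′ ≢ A → a′ ℕ.< α → b ℕ.< k → center h (a′ ℕ.* k ℕ.+ b) ≡ 0ℚ
  center-other-block h a′ b a′≢A a′<α b<k = begin
    center h (a′ ℕ.* k ℕ.+ b)                                           ≡⟨ center-∑ h (a′ ℕ.* k ℕ.+ b) ⟩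
    recip (k ^ α′) * ∑ (k ^ α) (λ r → δ (dig A r) H * entry k α r (a′ ℕ.* k ℕ.+ b))
                                                                        ≡⟨ cong (recip (k ^ α′) *_) (∑-cong (k ^ α) (λ r _ →
                                                                             cong (δ (dig A r) H *_) (entry-v¹ α r a′ b b<k))) ⟩
    recip (k ^ α′) * ∑ (k ^ α) (λ r → δ (dig A r) H * v¹ b (dig a′ r))  ≡⟨ cong (recip (k ^ α′) *_)
                                                                             (∑-digits-orthogonal α A a′ (a′≢A ∘ sym) A<α a′<α (λ d → δ d H) (v¹ b) (∑-v¹ b b<k)) ⟩
    recip (k ^ α′) * 0ℚ                                                 ≡⟨ *-zeroʳ (recip (k ^ α′)) ⟩
    0ℚ                                                                  ∎
    where
    open ≡-Reasoning
    H = toℕ h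

  module _ (r : Fin (k ^ α)) (j : Fin k) (r∈Cⱼ : inCluster k α a j r) where

    R = toℕ r

    dig-r : dig A R ≡ toℕ j
    dig-r = v¹-positive⇒≡ (toℕ j) (dig A R) (subst (0ℚ <_) (entry-v¹ α R A (toℕ j) (toℕ<n j)) r∈Cⱼ)

    sqError : Fin k → ℕ → ℚ
    sqError h t = (entry k α R t - center h t) * (entry k α R t - center h t)

    blockDist² : Fin k → ℕ → ℚ
    blockDist² h a′ = ∑ k (λ b → sqError h (a′ ℕ.* k ℕ.+ b))

    dist²-blocks : ∀ h → dist² (α ℕ.* k) (row k α r) (mean k α a h) ≡ ∑ α (blockDist² h)
    dist²-blocks h = trans (sumFin-toℕ (α ℕ.* k) (sqError h)) (∑-blocks α k (sqError h))

    blockDist²-own : ∀ h → blockDist² h A ≡ v¹-dist² (toℕ j) (toℕ h)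
    blockDist²-own h = ∑-cong k (λ b b<k → cong (λ x → x * x)
      (cong₂ _-_ (trans (entry-v¹ α R A b b<k) (cong (v¹ b) dig-r)) (center-own-block h b b<k)))

    blockDist²-other : ∀ h h′ a′ → a′ ≢ A → a′ ℕ.< α → blockDist² h a′ ≡ blockDist² h′ a′
    blockDist²-other h h′ a′ a′≢A a′<α = ∑-cong k (λ b b<k →
      cong (λ c → (entry k α R (a′ ℕ.* k ℕ.+ b) - c) * (entry k α R (a′ ℕ.* k ℕ.+ b) - c))
           (trans (center-other-block h a′ b a′≢A a′<α b<k) (sym (center-other-block h′ a′ b a′≢A a′<α b<k))))

    nearest-center : ∀ h → dist² (α ℕ.* k) (row k α r) (mean k α a j) ≤ dist² (α ℕ.* k) (row k α r) (mean k α a h)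
    nearest-center h = subst₂ _≤_ (sym (dist²-blocks j)) (sym (dist²-blocks h)) (∑-mono-≤ α blockwise)
      where
      blockwise : ∀ a′ → a′ ℕ.< α → blockDist² j a′ ≤ blockDist² h a′
      blockwise a′ a′<α with a′ ℕ.≟ A
      ... | yes refl = subst₂ _≤_ (sym (trans (blockDist²-own j) (v¹-dist²-self (toℕ j)))) (sym (blockDist²-own h))
                                  (v¹-dist²-nonNeg (toℕ j) (toℕ h) (toℕ<n j) (toℕ<n h))
      ... | no a′≢A  = ≤-reflexive (blockDist²-other j h a′ a′≢A a′<α)

    equidistant : ∀ h h′ → h ≢ j → h′ ≢ j →
                  dist² (α ℕ.* k) (row k α r) (mean k α a h) ≡ dist² (α ℕ.* k) (row k α r) (mean k α a h′)
    equidistant h h′ h≢j h′≢j = trans (dist²-blocks h) (trans (∑-cong α blockwise) (sym (dist²-blocks h′)))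
      where
      two : ∀ i → i ≢ j → blockDist² i A ≡ 1ℚ + 1ℚ
      two i i≢j = trans (blockDist²-own i)
        (v¹-dist²-distinct (toℕ j) (toℕ i) (λ j≡i → i≢j (toℕ-injective (sym j≡i))) (toℕ<n j) (toℕ<n i))
      blockwise : ∀ a′ → a′ ℕ.< α → blockDist² h a′ ≡ blockDist² h′ a′
      blockwise a′ a′<α with a′ ℕ.≟ A
      ... | yes refl = trans (two h h≢j) (sym (two h′ h′≢j))
      ... | no a′≢A  = blockDist²-other h h′ a′ a′≢A a′<α

open import Data.Nat using (ℕ; _^_; _*_)
open import Data.Nat renaming (_≤_ to _≤ℕ_)
open import Data.Fin using (Fin)
open import Data.Rational using (_≤_)
open import Data.Product using (_×_; _,_)
open import Relation.Binary.PropositionalEquality using (_≡_; _≢_)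

fact3 : (k α : ℕ) → 2 ≤ℕ k → 1 ≤ℕ α → (a : Fin α) → (r : Fin (k ^ α)) → (j : Fin k)
      → inCluster k α a j r
      → ((h : Fin k) → dist² (α * k) (row k α r) (mean k α a j) ≤ dist² (α * k) (row k α r) (mean k α a h))
        × ((h h′ : Fin k) → h ≢ j → h′ ≢ j
           → dist² (α * k) (row k α r) (mean k α a h) ≡ dist² (α * k) (row k α r) (mean k α a h′))
fact3 (suc (suc K)) (suc α′) (s≤s (s≤s z≤n)) (s≤s z≤n) a r j r∈Cⱼ =
  nearest-center r j r∈Cⱼ , equidistant r j r∈Cⱼ
  where open Clusters K α′ a
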